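{- Let $q=2$. Under $G_2$ there are exactly $4$ plane orbits and $4$ point orbits, and each is a union of $G_2^*$-orbits as follows. Plane orbits: (the $\Gamma$-planes) $\cup$ (the $\overline{1_{\mathcal C}}$-planes); the $2_{\mathcal C}$-planes; the $3_{\mathcal C}$-planes; the $0_{\mathcal C}$-planes. Point orbits: the $\mathcal C$-points; (the T-points) $\cup$ (the $0_\Gamma$-points); the $3_\Gamma$-points; the $1_\Gamma$-points. Here each of the listed sets of planes or points of a given type is a single $G_2^*$-orbit.
   Context: Let $\mathbb{F}_2$ be the field with 2 elements; points of $\mathrm{PG}(3,2)$ are written $\mathbf{P}(x_0,x_1,x_2,x_3)$. For $t\in\mathbb{F}_2$ put $P(t)=\mathbf{P}(t^3,t^2,t,1)$, and $P(\infty)=\mathbf{P}(1,0,0,0)$. The twisted cubic is $\mathcal{C}=\{P(0),P(1),P(\infty)\}=\{\mathbf P(0,0,0,1),\mathbf P(1,1,1,1),\mathbf P(1,0,0,0)\}$. $G_2$ is the group of all projectivities of $\mathrm{PG}(3,2)$ mapping $\mathcal C$ to itself. $G_2^*$ is the subgroup of $G_2$ of projectivities given by matrices $$M(a,b,c,d)=\begin{pmatrix} a^3&a^2c&ac^2&c^3\\ 3a^2b&a^2d+2abc&bc^2+2acd&3c^2d\\ 3ab^2&b^2c+2abd&ad^2+2bcd&3cd^2\\ b^3&b^2d&bd^2&d^3\end{pmatrix},\quad a,b,c,d\in\mathbb F_2,\ ad-bc\ne0,$$ with integer coefficients read in $\mathbb F_2$; it is isomorphic to $PGL(2,2)$. The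 osculating plane at $P(t)$, $t\in\mathbb F_2$, is $x_0-3tx_1+3t^2x_2-t^3x_3=0$ and at $P(\infty)$ it is $x_3=0$; these are the $\Gamma$-planes. The tangent at $P(t)$, $t\in\mathbb F_2$, is the line through $P(t)$ and $\mathbf P(3t^2,2t,1,0)$; at $P(\infty)$ it is the line through $\mathbf P(1,0,0,0)$ and $\mathbf P(0,1,0,0)$. Plane types: $\Gamma$-plane; $\overline{1_{\mathcal C}}$-plane: a plane that is not a $\Gamma$-plane and contains exactly one point of $\mathcal C$; $d_{\mathcal C}$-plane ($d=0,2,3$): a plane containing exactly $d$ points of $\mathcal C$. Point types: $\mathcal C$-point: a point of $\mathcal C$; T-point: a point not on $\mathcal C$ lying on a tangent; $\mu_\Gamma$-point ($\mu\in\{0,1,3\}$): a point not on $\mathcal C$ and on no tangent, lying on exactly $\mu$ $\Gamma$-planes. -}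

module Defs where

open import Data.Bool using (Bool; true; false; _∧_; _xor_; not; if_then_else_)
open import Data.Nat using (ℕ; zero; suc)
open import Data.Fin using (Fin; zero; suc)
open import Data.Fin.Properties using (_≟_)
open import Data.Vec using (Vec; []; _∷_; map; zipWith; foldr; tabulate; lookup; replicate)
open import Data.List using (List; []; _∷_)
open import Data.List.Relation.Unary.Any using (Any)
open import Data.List.Membership.Propositional using (_∈_)
open import Data.Product using (Σ; ∃; _×_; _,_)
open import Data.Sum using (_⊎_)
open import Function.Bundles using (_⇔_)
open import Relation.Nullary using (¬_)
open import Relation.Nullary.Decidable using (⌊_⌋)
open import Relation.Binary.PropositionalEquality using (_≡_; _≢_)

-- The field F₂ is Bool with addition _xor_ and multiplication _∧_.

F₂ : Set
F₂ = Bool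

-- integer coefficients read in F₂
ι : ℕ → F₂
ι zero = false
ι (suc zero) = true
ι (suc (suc n)) = ι n

neg : F₂ → F₂
neg x = x

sq : F₂ → F₂
sq x = x ∧ x

cube : F₂ → F₂
cube x = x ∧ x ∧ x

V4 : Set
V4 = Vec F₂ 4

Mat : Set
Mat = Vec V4 4

zeroV : V4
zeroV = replicate 4 false

_⊕_ : V4 → V4 → V4
_⊕_ = zipWith _xor_

dot : ∀ {n} → Vec F₂ n → Vec F₂ n → F₂
dot u v = foldr _ _xor_ false (zipWith _∧_ u v)

-- row vector times matrix (rows of M are the entries of the Vec)
vecMat : V4 → Mat → V4
vecMat x M = tabulate (λ j → dot x (map (λ row → lookup row j) M))

matMul : Mat → Mat → Mat
matMul A B = map (λ row → vecMat row B) A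

idMat : Mat
idMat = tabulate (λ i → tabulate (λ j → ⌊ i ≟ j ⌋))

-- PG(3,2): points are nonzero vectors of F₂⁴ (over F₂ each projective
-- point has exactly one nonzero representative); planes are given by
-- nonzero coordinate vectors u, the plane being {x | u·x = 0}.

IsPoint : V4 → Set
IsPoint x = x ≢ zeroV

IsPlane : V4 → Set
IsPlane u = u ≢ zeroV

Inc : V4 → V4 → Set
Inc u x = dot u x ≡ false

inc? : V4 → V4 → Bool
inc? u x = not (dot u x)

countTrue : List Bool → ℕ
countTrue [] = zero
countTrue (true ∷ bs) = suc (countTrue bs)
countTrue (false ∷ bs) = countTrue bs

mapL : ∀ {A B : Set} → (A → B) → List A → List B
mapL f [] = []
mapL f (x ∷ xs) = f x ∷ mapL f xs

-- Projectivities of PG(3,2) = invertible 4×4 matrices over F₂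
-- (scalars are trivial over F₂), acting on points by x ↦ x M.

IsProjectivity : Mat → Set
IsProjectivity M = Σ Mat λ N → (matMul N M ≡ idMat) × (matMul M N ≡ idMat)

Pt : F₂ → V4
Pt t = cube t ∷ sq t ∷ t ∷ true ∷ []

P∞ : V4
P∞ = true ∷ false ∷ false ∷ false ∷ []

cubicPts : List V4
cubicPts = Pt false ∷ Pt true ∷ P∞ ∷ []

OnC : V4 → Set
OnC x = x ∈ cubicPts

InG₂ : Mat → Set
InG₂ M = IsProjectivity M
       × (∀ x → OnC x → OnC (vecMat x M))
       × (∀ y → OnC y → ∃ λ x → OnC x × vecMat x M ≡ y)

Mabcd : F₂ → F₂ → F₂ → F₂ → Mat
Mabcd a b c d =
    (cube a ∷ (sq a ∧ c) ∷ (a ∧ sq c) ∷ cube c ∷ [])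
  ∷ ((ι 3 ∧ sq a ∧ b) ∷ ((sq a ∧ d) xor (ι 2 ∧ a ∧ b ∧ c))
       ∷ ((b ∧ sq c) xor (ι 2 ∧ a ∧ c ∧ d)) ∷ (ι 3 ∧ sq c ∧ d) ∷ [])
  ∷ ((ι 3 ∧ a ∧ sq b) ∷ ((sq b ∧ c) xor (ι 2 ∧ a ∧ b ∧ d))
       ∷ ((a ∧ sq d) xor (ι 2 ∧ b ∧ c ∧ d)) ∷ (ι 3 ∧ c ∧ sq d) ∷ [])
  ∷ (cube b ∷ (sq b ∧ d) ∷ (b ∧ sq d) ∷ cube d ∷ [])
  ∷ []

InG₂* : Mat → Set
InG₂* M = ∃ λ a → ∃ λ b → ∃ λ c → ∃ λ d →
          ((a ∧ d) xor (neg (b ∧ c)) ≡ true) × M ≡ Mabcd a b c d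

osc : F₂ → V4
osc t = true ∷ neg (ι 3 ∧ t) ∷ (ι 3 ∧ sq t) ∷ neg (cube t) ∷ []

osc∞ : V4
osc∞ = false ∷ false ∷ false ∷ true ∷ []

gammaPlanes : List V4
gammaPlanes = osc false ∷ osc true ∷ osc∞ ∷ []

line : V4 → V4 → List V4
line a b = a ∷ b ∷ (a ⊕ b) ∷ []

tangentAt : F₂ → List V4
tangentAt t = line (Pt t) (ι 3 ∧ sq t ∷ ι 2 ∧ t ∷ true ∷ false ∷ [])

tangent∞ : List V4
tangent∞ = line P∞ (false ∷ true ∷ false ∷ false ∷ [])

tangents : List (List V4)
tangents = tangentAt false ∷ tangentAt true ∷ tangent∞ ∷ []

OnTangent : V4 → Set
OnTangent x = Any (λ l → x ∈ l) tangents

#C : V4 → ℕ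
#C u = countTrue (mapL (inc? u) cubicPts)

ΓPlane : V4 → Set
ΓPlane u = u ∈ gammaPlanes

OneBarPlane : V4 → Set
OneBarPlane u = ¬ ΓPlane u × #C u ≡ 1

dCPlane : ℕ → V4 → Set
dCPlane d u = #C u ≡ d

CPoint : V4 → Set
CPoint = OnC

TPoint : V4 → Set
TPoint x = ¬ OnC x × OnTangent x

#Γ : V4 → ℕ
#Γ x = countTrue (mapL (λ u → inc? u x) gammaPlanes)

μΓPoint : ℕ → V4 → Set
μΓPoint μ x = ¬ OnC x × ¬ OnTangent x × #Γ x ≡ μ

PointAct : Mat → V4 → V4 → Set
PointAct M x y = vecMat x M ≡ y

-- M maps plane u onto plane u' : the image of {x | u·x=0} under x ↦ xM
-- is {y | u'·y = 0}  (M is invertible)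
PlaneAct : Mat → V4 → V4 → Set
PlaneAct M u u' = ∀ x → Inc u x ⇔ Inc u' (vecMat x M)

IsOrbitPartition : (G : Mat → Set) (Act : Mat → V4 → V4 → Set)
                   (Obj : V4 → Set) (n : ℕ) (S : Fin n → V4 → Set) → Set
IsOrbitPartition G Act Obj n S =
    (∀ i → ∃ λ x → Obj x × S i x)
  × (∀ i x y → Obj x → Obj y → S i x →
       (S i y ⇔ (∃ λ M → G M × Act M x y)))
  × (∀ x → Obj x → ∃ λ i → S i x)
  × (∀ i j x → Obj x → S i x → S j x → i ≡ j)

G₂PlaneOrbits : Fin 4 → V4 → Set
G₂PlaneOrbits zero u = ΓPlane u ⊎ OneBarPlane u
G₂PlaneOrbits (suc zero) u = dCPlane 2 u
G₂PlaneOrbits (suc (suc zero)) u = dCPlane 3 u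
G₂PlaneOrbits (suc (suc (suc zero))) u = dCPlane 0 u

G₂PointOrbits : Fin 4 → V4 → Set
G₂PointOrbits zero x = CPoint x
G₂PointOrbits (suc zero) x = TPoint x ⊎ μΓPoint 0 x
G₂PointOrbits (suc (suc zero)) x = μΓPoint 3 x
G₂PointOrbits (suc (suc (suc zero))) x = μΓPoint 1 x

G₂*PlaneOrbits : Fin 5 → V4 → Set
G₂*PlaneOrbits zero u = ΓPlane u
G₂*PlaneOrbits (suc zero) u = OneBarPlane u
G₂*PlaneOrbits (suc (suc zero)) u = dCPlane 2 u
G₂*PlaneOrbits (suc (suc (suc zero))) u = dCPlane 3 u
G₂*PlaneOrbits (suc (suc (suc (suc zero)))) u = dCPlane 0 u

G₂*PointOrbits : Fin 5 → V4 → Set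
G₂*PointOrbits zero x = CPoint x
G₂*PointOrbits (suc zero) x = TPoint x
G₂*PointOrbits (suc (suc zero)) x = μΓPoint 0 x
G₂*PointOrbits (suc (suc (suc zero))) x = μΓPoint 3 x
G₂*PointOrbits (suc (suc (suc (suc zero)))) x = μΓPoint 1 x

{-# OPTIONS --safe #-}
module Submission where

-- Each family of the theorem is the set of fibres of a "kind" function on the
-- nonzero vectors of F₂⁴, so it suffices that every kind is attained, that the
-- group links any two vectors of the same kind, and that the kind is invariant.
-- G₂* consists of the six matrices M(a,b,c,d), so for it both properties are
-- finite checks.  G₂ is only known abstractly: a projectivity fixing C permutes
-- its three points, which form a basis of the plane x₁ = x₂.  Hence it preserves
-- the number of points of C on a plane, maps that plane onto itself while
-- permuting the coordinates with respect to P(0), P(1), P(∞), and the kind of a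
-- point only depends on these coordinates up to order (off the plane it is
-- constant).  Transitivity of G₂ follows from G₂* ⊆ G₂ together with one
-- involution K fixing C pointwise, which joins the G₂*-orbits of T-points and
-- 0_Γ-points, and of Γ-planes and 1̄_C-planes.

open import Defs
open import Data.Bool using (Bool; true; false; _∧_; _xor_; not)
open import Data.Bool.Properties using (xor-∧-commutativeRing; ∧-comm; ∧-zeroʳ)
import Data.Bool.Properties as Bool
open import Data.Fin using (Fin; zero; suc; #_)
import Data.Fin.Properties as Fin
open import Data.Fin.Subset.Properties using (anySubset?)
open import Data.List using (List; []; _∷_)
import Data.List as List
import Data.List.Properties as List
open import Data.List.Membership.Propositional using (_∈_)
open import Data.List.Membership.Propositional.Properties using (∈-map⁺)
import Data.List.Membership.DecPropositional as DecMembership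
open import Data.List.Relation.Unary.Any using (here; there)
import Data.List.Relation.Unary.Any as Any
import Data.List.Relation.Unary.All as ListAll
open import Data.Maybe using (nothing)
open import Data.Nat using (ℕ)
import Data.Nat as ℕ
open import Data.Product using (∃; _×_; _,_; proj₁; proj₂)
open import Data.Vec using (Vec; []; _∷_; map; zipWith; foldr; replicate; lookup; toList)
open import Data.Vec.Properties using (map-∘; map-cong; map-id; zipWith-comm; tabulate-cong)
import Data.Vec.Properties as Vec
open import Data.Vec.Relation.Unary.All using (All; []; _∷_)
open import Function using (_∘_)
open import Function.Bundles using (_⇔_; mk⇔; module Equivalence)
open import Relation.Nullary using (Dec; yes; no; ¬_; ¬?; _×-dec_; _⊎-dec_; _→-dec_)
open import Relation.Nullary.Decidable using (map′; decidable-stable; from-yes)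
open import Relation.Binary.PropositionalEquality
open import Tactic.RingSolver using (solve-∀)
open import Tactic.RingSolver.Core.AlmostCommutativeRing using (AlmostCommutativeRing; fromCommutativeRing)
open ≡-Reasoning

-- Orbit partitions from a complete invariant

Reach : (Mat → Set) → (Mat → V4 → V4 → Set) → V4 → V4 → Set
Reach G Act x y = ∃ λ M → G M × Act M x y

Classifies : ∀ {n} → (V4 → Set) → (Fin n → V4 → Set) → (V4 → Fin n) → Set
Classifies Obj S kind = ∀ x → Obj x → S (kind x) x × (∀ i → S i x → kind x ≡ i)

SurjectiveOn : ∀ {n} → (V4 → Set) → (V4 → Fin n) → Set
SurjectiveOn Obj kind = ∀ i → ∃ λ x → Obj x × kind x ≡ i

TransitiveOnFibres : ∀ {n} → (Mat → Set) → (Mat → V4 → V4 → Set) → (V4 → Set) → (V4 → Fin n) → Set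
TransitiveOnFibres G Act Obj kind = ∀ x y → Obj x → Obj y → kind x ≡ kind y → Reach G Act x y

Invariant : ∀ {n} → (Mat → Set) → (Mat → V4 → V4 → Set) → (V4 → Fin n) → Set
Invariant G Act kind = ∀ M x y → G M → Act M x y → kind x ≡ kind y

isOrbitPartition-byCompleteInvariant :
  ∀ {G Act Obj n S} (kind : V4 → Fin n) → Classifies Obj S kind → SurjectiveOn Obj kind →
  TransitiveOnFibres G Act Obj kind → Invariant G Act kind → IsOrbitPartition G Act Obj n S
isOrbitPartition-byCompleteInvariant {G} {Act} {Obj} {n} {S} kind classifies surjective transitive invariant =
  inhabited , orbit , (λ x ox → kind x , proj₁ (classifies x ox)) , disjoint
  where
  inKindClass : ∀ {x i} → Obj x → kind x ≡ i → S i x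
  inKindClass {x} ox refl = proj₁ (classifies x ox)
  kind≡ : ∀ {x i} → Obj x → S i x → kind x ≡ i
  kind≡ {x} {i} ox = proj₂ (classifies x ox) i
  inhabited : ∀ i → ∃ λ x → Obj x × S i x
  inhabited i with surjective i
  ... | x , ox , kx≡i = x , ox , inKindClass ox kx≡i
  orbit : ∀ i x y → Obj x → Obj y → S i x → S i y ⇔ Reach G Act x y
  orbit i x y ox oy sx = mk⇔ (λ sy → transitive x y ox oy (trans (kind≡ ox sx) (sym (kind≡ oy sy))))
                             (λ (M , g , act) → inKindClass oy (trans (sym (invariant M x y g act)) (kind≡ ox sx)))
  disjoint : ∀ i j x → Obj x → S i x → S j x → i ≡ j
  disjoint i j x ox si sj = trans (sym (kind≡ ox si)) (kind≡ ox sj)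

-- Subset n is Vec Bool n, so anySubset? searches all vectors over F₂.
∀-vec? : ∀ {n} {P : Vec F₂ n → Set} → (∀ x → Dec (P x)) → Dec (∀ x → P x)
∀-vec? P? = map′ (λ ¬∃¬ x → decidable-stable (P? x) (λ ¬px → ¬∃¬ (x , ¬px)))
                 (λ ∀P (x , ¬px) → ¬px (∀P x))
                 (¬? (anySubset? (¬? ∘ P?)))

_≟V_ : (x y : V4) → Dec (x ≡ y)
_≟V_ = Vec.≡-dec Bool._≟_

_≟M_ : (M N : Mat) → Dec (M ≡ N)
_≟M_ = Vec.≡-dec _≟V_

open DecMembership _≟V_ using (_∈?_)

nonzero? : ∀ x → Dec (x ≢ zeroV)
nonzero? x = ¬? (x ≟V zeroV)

Inc? : ∀ u x → Dec (Inc u x)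
Inc? u x = dot u x Bool.≟ false

infixr 25 _·_

_·_ : ∀ {n} → F₂ → Vec F₂ n → Vec F₂ n
α · v = map (α ∧_) v

combination : ∀ {n} → Vec F₂ n → Vec V4 n → V4
combination []       []       = zeroV
combination (α ∷ αs) (v ∷ vs) = α · v ⊕ combination αs vs

private
  F₂-ring : AlmostCommutativeRing _ _
  F₂-ring = fromCommutativeRing xor-∧-commutativeRing (λ _ → nothing)

dot-comm : ∀ {n} (u v : Vec F₂ n) → dot u v ≡ dot v u
dot-comm u v = cong (foldr _ _xor_ false) (zipWith-comm ∧-comm u v)

dot-zeroˡ : ∀ {n} (c : Vec F₂ n) → dot (replicate n false) c ≡ false
dot-zeroˡ []      = refl
dot-zeroˡ (_ ∷ c) = dot-zeroˡ c

dot-xorˡ : ∀ {n} (x y c : Vec F₂ n) → dot (zipWith _xor_ x y) c ≡ dot x c xor dot y c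
dot-xorˡ []      []      []      = refl
dot-xorˡ (a ∷ x) (b ∷ y) (m ∷ c) rewrite dot-xorˡ x y c = distrib a b m (dot x c) (dot y c)
  where
  distrib : ∀ a b m r s → ((a xor b) ∧ m) xor (r xor s) ≡ ((a ∧ m) xor r) xor ((b ∧ m) xor s)
  distrib = solve-∀ F₂-ring

dot-·ˡ : ∀ {n} α (x c : Vec F₂ n) → dot (α · x) c ≡ α ∧ dot x c
dot-·ˡ α []      []      = sym (∧-zeroʳ α)
dot-·ˡ α (a ∷ x) (m ∷ c) rewrite dot-·ˡ α x c = distrib α a m (dot x c)
  where
  distrib : ∀ α a m r → ((α ∧ a) ∧ m) xor (α ∧ r) ≡ α ∧ ((a ∧ m) xor r)
  distrib = solve-∀ F₂-ring

column : Fin 4 → Mat → V4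
column j M = map (λ row → lookup row j) M

vecMat-⊕ : ∀ x y M → vecMat (x ⊕ y) M ≡ vecMat x M ⊕ vecMat y M
vecMat-⊕ x y M = tabulate-cong {g = λ j → dot x (column j M) xor dot y (column j M)}
                               (λ j → dot-xorˡ x y (column j M))

vecMat-· : ∀ α x M → vecMat (α · x) M ≡ α · vecMat x M
vecMat-· α x M = tabulate-cong {g = λ j → α ∧ dot x (column j M)} (λ j → dot-·ˡ α x (column j M))

vecMat-zeroV : ∀ M → vecMat zeroV M ≡ zeroV
vecMat-zeroV M = tabulate-cong {g = λ _ → false} (λ j → dot-zeroˡ (column j M))

vecMat≡combination : ∀ x M → vecMat x M ≡ combination x M
vecMat≡combination (_ ∷ _ ∷ _ ∷ _ ∷ [])
  ((_ ∷ _ ∷ _ ∷ _ ∷ []) ∷ (_ ∷ _ ∷ _ ∷ _ ∷ []) ∷ (_ ∷ _ ∷ _ ∷ _ ∷ []) ∷ (_ ∷ _ ∷ _ ∷ _ ∷ []) ∷ []) = refl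

vecMat-combination : ∀ {n} (αs : Vec F₂ n) vs M →
                     vecMat (combination αs vs) M ≡ combination αs (map (λ v → vecMat v M) vs)
vecMat-combination []       []       M = vecMat-zeroV M
vecMat-combination (α ∷ αs) (v ∷ vs) M = begin
  vecMat (α · v ⊕ combination αs vs) M                          ≡⟨ vecMat-⊕ (α · v) _ M ⟩
  vecMat (α · v) M ⊕ vecMat (combination αs vs) M               ≡⟨ cong₂ _⊕_ (vecMat-· α v M)
                                                                             (vecMat-combination αs vs M) ⟩
  α · vecMat v M ⊕ combination αs (map (λ v → vecMat v M) vs)   ∎

vecMat-matMul : ∀ x M N → vecMat (vecMat x M) N ≡ vecMat x (matMul M N)
vecMat-matMul x M N = begin
  vecMat (vecMat x M) N                          ≡⟨ cong (λ v → vecMat v N) (vecMat≡combination x M) ⟩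
  vecMat (combination x M) N                     ≡⟨ vecMat-combination x M N ⟩
  combination x (map (λ row → vecMat row N) M)   ≡⟨ vecMat≡combination x (matMul M N) ⟨
  vecMat x (matMul M N)                          ∎

vecMat-idMat : ∀ x → vecMat x idMat ≡ x
vecMat-idMat = from-yes (∀-vec? λ x → vecMat x idMat ≟V x)

matMul-assoc : ∀ A B C → matMul (matMul A B) C ≡ matMul A (matMul B C)
matMul-assoc A B C = begin
  map (λ row → vecMat row C) (map (λ row → vecMat row B) A)   ≡⟨ map-∘ _ _ A ⟨
  map (λ row → vecMat (vecMat row B) C) A                      ≡⟨ map-cong (λ row → vecMat-matMul row B C) A ⟩
  map (λ row → vecMat row (matMul B C)) A                      ∎

matMul-identityʳ : ∀ A → matMul A idMat ≡ A
matMul-identityʳ A = trans (map-cong vecMat-idMat A) (map-id A)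

matMul-inverse : ∀ {M N M' N'} → matMul N M ≡ idMat → matMul N' M' ≡ idMat →
                 matMul (matMul N' N) (matMul M M') ≡ idMat
matMul-inverse {M} {N} {M'} {N'} NM≡I N'M'≡I = begin
  matMul (matMul N' N) (matMul M M')   ≡⟨ matMul-assoc (matMul N' N) M M' ⟨
  matMul (matMul (matMul N' N) M) M'   ≡⟨ cong (λ A → matMul A M') (matMul-assoc N' N M) ⟩
  matMul (matMul N' (matMul N M)) M'   ≡⟨ cong (λ A → matMul (matMul N' A) M') NM≡I ⟩
  matMul (matMul N' idMat) M'          ≡⟨ cong (λ A → matMul A M') (matMul-identityʳ N') ⟩
  matMul N' M'                         ≡⟨ N'M'≡I ⟩
  idMat                                ∎

vecMat-cancel : ∀ {M N} → matMul M N ≡ idMat → ∀ x → vecMat (vecMat x M) N ≡ x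
vecMat-cancel {M} {N} MN≡I x = begin
  vecMat (vecMat x M) N   ≡⟨ vecMat-matMul x M N ⟩
  vecMat x (matMul M N)   ≡⟨ cong (vecMat x) MN≡I ⟩
  vecMat x idMat          ≡⟨ vecMat-idMat x ⟩
  x                       ∎

Inc-combination : ∀ {n} u (αs : Vec F₂ n) {vs} → All (Inc u) vs → Inc u (combination αs vs)
Inc-combination u []       []                     = trans (dot-comm u zeroV) (dot-zeroˡ u)
Inc-combination u (α ∷ αs) {v ∷ vs} (v∈u ∷ vs⊆u) = begin
  dot u (α · v ⊕ combination αs vs)              ≡⟨ dot-comm u _ ⟩
  dot (α · v ⊕ combination αs vs) u              ≡⟨ dot-xorˡ (α · v) _ u ⟩
  dot (α · v) u xor dot (combination αs vs) u    ≡⟨ cong₂ _xor_ (dot-·ˡ α v u) (dot-comm _ u) ⟩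
  (α ∧ dot v u) xor dot u (combination αs vs)    ≡⟨ cong₂ (λ a b → (α ∧ a) xor b) (trans (dot-comm v u) v∈u)
                                                                                   (Inc-combination u αs vs⊆u) ⟩
  (α ∧ false) xor false                          ≡⟨ cong (_xor false) (∧-zeroʳ α) ⟩
  false                                          ∎

⇔false⇒≡ : ∀ {a b : Bool} → (a ≡ false ⇔ b ≡ false) → a ≡ b
⇔false⇒≡ {false} {false} _   = refl
⇔false⇒≡ {true}  {true}  _   = refl
⇔false⇒≡ {false} {true}  a⇔b = sym (Equivalence.to a⇔b refl)
⇔false⇒≡ {true}  {false} a⇔b = Equivalence.from a⇔b refl

PlaneAct⇔ : ∀ M u u' → PlaneAct M u u' ⇔ (∀ x → dot u x ≡ dot u' (vecMat x M))
PlaneAct⇔ M u u' = mk⇔ (λ act x → ⇔false⇒≡ (act x))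
                        (λ eq x → mk⇔ (trans (sym (eq x))) (trans (eq x)))

pointAct? : ∀ M x y → Dec (PointAct M x y)
pointAct? M x y = vecMat x M ≟V y

planeAct? : ∀ M u u' → Dec (PlaneAct M u u')
planeAct? M u u' = map′ (Equivalence.from (PlaneAct⇔ M u u')) (Equivalence.to (PlaneAct⇔ M u u'))
                        (∀-vec? λ x → dot u x Bool.≟ dot u' (vecMat x M))

ActionLaw : (Mat → V4 → V4 → Set) → Set
ActionLaw Act = ∀ M M' x y z → Act M x y → Act M' y z → Act (matMul M M') x z

PointAct-matMul : ActionLaw PointAct
PointAct-matMul M M' x _ _ refl refl = sym (vecMat-matMul x M M')

PlaneAct-matMul : ActionLaw PlaneAct
PlaneAct-matMul M M' u u' u'' act act' x =
  subst (λ y → Inc u x ⇔ Inc u'' y) (vecMat-matMul x M M')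
        (mk⇔ (Equivalence.to (act' _) ∘ Equivalence.to (act x))
             (Equivalence.from (act x) ∘ Equivalence.from (act' _)))

MapsC : Mat → Set
MapsC M = ∀ x → OnC x → OnC (vecMat x M)

mapsC? : ∀ M → Dec (MapsC M)
mapsC? M = map′ (λ images x x∈C → ListAll.lookup images x∈C) (λ mapsC → ListAll.tabulate (mapsC _))
                (ListAll.all? (λ x → vecMat x M ∈? cubicPts) cubicPts)

MapsC-matMul : ∀ {M M'} → MapsC M → MapsC M' → MapsC (matMul M M')
MapsC-matMul {M} {M'} mapsC mapsC' x x∈C = subst OnC (vecMat-matMul x M M') (mapsC' _ (mapsC x x∈C))

InG₂-byInverse : ∀ {M} N → matMul N M ≡ idMat → matMul M N ≡ idMat → MapsC M → MapsC N → InG₂ M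
InG₂-byInverse N NM≡I MN≡I mapsC mapsC⁻¹ =
  (N , NM≡I , MN≡I) , mapsC , λ y y∈C → vecMat y N , mapsC⁻¹ y y∈C , vecMat-cancel NM≡I y

G₂-inverse : ∀ {M} → InG₂ M → Mat
G₂-inverse ((N , _) , _) = N

G₂-inverse-MapsC : ∀ {M} (g : InG₂ M) → MapsC (G₂-inverse g)
G₂-inverse-MapsC ((N , _ , MN≡I) , _ , onto) c c∈C with onto c c∈C
... | x , x∈C , refl = subst OnC (sym (vecMat-cancel MN≡I x)) x∈C

InG₂-matMul : ∀ {M M'} → InG₂ M → InG₂ M' → InG₂ (matMul M M')
InG₂-matMul g@((N , NM≡I , MN≡I) , mapsC , _) g'@((N' , N'M'≡I , M'N'≡I) , mapsC' , _) =
  InG₂-byInverse (matMul N' N) (matMul-inverse NM≡I N'M'≡I) (matMul-inverse M'N'≡I MN≡I)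
    (MapsC-matMul mapsC mapsC') (MapsC-matMul (G₂-inverse-MapsC g') (G₂-inverse-MapsC g))

Mv : V4 → Mat
Mv (a ∷ b ∷ c ∷ d ∷ []) = Mabcd a b c d

det : V4 → F₂
det (a ∷ b ∷ c ∷ d ∷ []) = (a ∧ d) xor neg (b ∧ c)

-- Over F₂ the inverse of (a b ; c d) with ad + bc = 1 is (d b ; c a).
adj : V4 → V4
adj (a ∷ b ∷ c ∷ d ∷ []) = d ∷ b ∷ c ∷ a ∷ []

InG₂*-Mv : ∀ v → det v ≡ true → InG₂* (Mv v)
InG₂*-Mv (a ∷ b ∷ c ∷ d ∷ []) det≡1 = a , b , c , d , det≡1 , refl

InG₂-Mv : ∀ v → det v ≡ true → InG₂ (Mv v)
InG₂-Mv v det≡1 = let NM≡I , MN≡I , mapsC , mapsC⁻¹ = checked v det≡1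
                  in InG₂-byInverse (Mv (adj v)) NM≡I MN≡I mapsC mapsC⁻¹
  where
  checked : ∀ v → det v ≡ true →
            matMul (Mv (adj v)) (Mv v) ≡ idMat × matMul (Mv v) (Mv (adj v)) ≡ idMat ×
            MapsC (Mv v) × MapsC (Mv (adj v))
  checked = from-yes (∀-vec? λ v → det v Bool.≟ true →-dec
              (matMul (Mv (adj v)) (Mv v) ≟M idMat ×-dec (matMul (Mv v) (Mv (adj v)) ≟M idMat ×-dec
               (mapsC? (Mv v) ×-dec mapsC? (Mv (adj v))))))

InG₂*⇒InG₂ : ∀ {M} → InG₂* M → InG₂ M
InG₂*⇒InG₂ (a , b , c , d , det≡1 , refl) = InG₂-Mv (a ∷ b ∷ c ∷ d ∷ []) det≡1

-- Fixes P(0), P(1) and P(∞), so it lies in G₂, but it is not of the form M(a,b,c,d).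
K : Mat
K = (true  ∷ false ∷ false ∷ false ∷ [])
  ∷ (false ∷ false ∷ true  ∷ true  ∷ [])
  ∷ (false ∷ true  ∷ false ∷ true  ∷ [])
  ∷ (false ∷ false ∷ false ∷ true  ∷ [])
  ∷ []

InG₂-K : InG₂ K
InG₂-K = InG₂-byInverse K refl refl mapsC mapsC
  where
  mapsC : MapsC K
  mapsC = from-yes (mapsC? K)

C⃗ : Vec V4 3
C⃗ = Pt false ∷ Pt true ∷ P∞ ∷ []

orderingsOfC : List (Vec V4 3)
orderingsOfC = (P₀ ∷ P₁ ∷ P∞ ∷ []) ∷ (P₀ ∷ P∞ ∷ P₁ ∷ []) ∷ (P₁ ∷ P₀ ∷ P∞ ∷ [])
             ∷ (P₁ ∷ P∞ ∷ P₀ ∷ []) ∷ (P∞ ∷ P₀ ∷ P₁ ∷ []) ∷ (P∞ ∷ P₁ ∷ P₀ ∷ []) ∷ []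
  where
  P₀ = Pt false
  P₁ = Pt true

Covers : Vec V4 3 → Set
Covers t = ∀ y → OnC y → y ∈ toList t

covering-isOrdering : ∀ {a b c} → OnC a → OnC b → OnC c → Covers (a ∷ b ∷ c ∷ []) →
                      (a ∷ b ∷ c ∷ []) ∈ orderingsOfC
covering-isOrdering a∈C b∈C c∈C = ListAll.lookup (ListAll.lookup (ListAll.lookup checked a∈C) b∈C) c∈C
  where
  covers? : ∀ t → Dec (Covers t)
  covers? t = ∀-vec? λ y → y ∈? cubicPts →-dec y ∈? toList t
  _∈?ₒ_ : (t : Vec V4 3) (ts : List (Vec V4 3)) → Dec (t ∈ ts)
  _∈?ₒ_ = DecMembership._∈?_ (Vec.≡-dec _≟V_)
  checked : ListAll.All (λ a → ListAll.All (λ b → ListAll.All (λ c →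
              Covers (a ∷ b ∷ c ∷ []) → (a ∷ b ∷ c ∷ []) ∈ orderingsOfC) cubicPts) cubicPts) cubicPts
  checked = from-yes (ListAll.all? (λ a → ListAll.all? (λ b → ListAll.all? (λ c →
              covers? (a ∷ b ∷ c ∷ []) →-dec (a ∷ b ∷ c ∷ []) ∈?ₒ orderingsOfC) cubicPts) cubicPts) cubicPts)

G₂-permutes-C : ∀ {M} → InG₂ M → map (λ c → vecMat c M) C⃗ ∈ orderingsOfC
G₂-permutes-C {M} (_ , mapsC , onto) =
  covering-isOrdering (mapsC _ (here refl)) (mapsC _ (there (here refl))) (mapsC _ (there (there (here refl))))
                      covers
  where
  covers : Covers (map (λ c → vecMat c M) C⃗)
  covers y y∈C with onto y y∈C
  ... | x , x∈C , refl = ∈-map⁺ (λ c → vecMat c M) x∈C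

onC? : ∀ x → Dec (OnC x)
onC? x = x ∈? cubicPts

onTangent? : ∀ x → Dec (OnTangent x)
onTangent? x = Any.any? (x ∈?_) tangents

ΓPlane? : ∀ u → Dec (ΓPlane u)
ΓPlane? u = u ∈? gammaPlanes

TPoint? : ∀ x → Dec (TPoint x)
TPoint? x = ¬? (onC? x) ×-dec onTangent? x

μΓPoint? : ∀ μ x → Dec (μΓPoint μ x)
μΓPoint? μ x = ¬? (onC? x) ×-dec (¬? (onTangent? x) ×-dec (#Γ x ℕ.≟ μ))

OneBarPlane? : ∀ u → Dec (OneBarPlane u)
OneBarPlane? u = ¬? (ΓPlane? u) ×-dec (#C u ℕ.≟ 1)

dCPlane? : ∀ d u → Dec (dCPlane d u)
dCPlane? d u = #C u ℕ.≟ d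

byCount : ℕ → Fin 4
byCount 1 = # 0
byCount 2 = # 1
byCount 3 = # 2
byCount _ = # 3

planeKind : V4 → Fin 4
planeKind u = byCount (#C u)

planeKind* : V4 → Fin 5
planeKind* u with ΓPlane? u
... | yes _ = # 0
... | no _  = suc (planeKind u)

pointKind : V4 → Fin 4
pointKind x with onC? x | onTangent? x | #Γ x
... | yes _ | _     | _ = # 0
... | no _  | yes _ | _ = # 1
... | no _  | no _  | 0 = # 1
... | no _  | no _  | 3 = # 2
... | no _  | no _  | _ = # 3

pointKind* : V4 → Fin 5
pointKind* x with onC? x | onTangent? x | #Γ x
... | yes _ | _     | _ = # 0
... | no _  | yes _ | _ = # 1
... | no _  | no _  | 0 = # 2
... | no _  | no _  | 3 = # 3
... | no _  | no _  | _ = # 4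

G₂PlaneOrbits? : ∀ i u → Dec (G₂PlaneOrbits i u)
G₂PlaneOrbits? zero                   u = ΓPlane? u ⊎-dec OneBarPlane? u
G₂PlaneOrbits? (suc zero)             u = dCPlane? 2 u
G₂PlaneOrbits? (suc (suc zero))       u = dCPlane? 3 u
G₂PlaneOrbits? (suc (suc (suc zero))) u = dCPlane? 0 u

G₂PointOrbits? : ∀ i x → Dec (G₂PointOrbits i x)
G₂PointOrbits? zero                   x = onC? x
G₂PointOrbits? (suc zero)             x = TPoint? x ⊎-dec μΓPoint? 0 x
G₂PointOrbits? (suc (suc zero))       x = μΓPoint? 3 x
G₂PointOrbits? (suc (suc (suc zero))) x = μΓPoint? 1 x

G₂*PlaneOrbits? : ∀ i u → Dec (G₂*PlaneOrbits i u)
G₂*PlaneOrbits? zero                         u = ΓPlane? u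
G₂*PlaneOrbits? (suc zero)                   u = OneBarPlane? u
G₂*PlaneOrbits? (suc (suc zero))             u = dCPlane? 2 u
G₂*PlaneOrbits? (suc (suc (suc zero)))       u = dCPlane? 3 u
G₂*PlaneOrbits? (suc (suc (suc (suc zero)))) u = dCPlane? 0 u

G₂*PointOrbits? : ∀ i x → Dec (G₂*PointOrbits i x)
G₂*PointOrbits? zero                         x = onC? x
G₂*PointOrbits? (suc zero)                   x = TPoint? x
G₂*PointOrbits? (suc (suc zero))             x = μΓPoint? 0 x
G₂*PointOrbits? (suc (suc (suc zero)))       x = μΓPoint? 3 x
G₂*PointOrbits? (suc (suc (suc (suc zero)))) x = μΓPoint? 1 x

classifies? : ∀ {n} {S : Fin n → V4 → Set} → (∀ i x → Dec (S i x)) → (kind : V4 → Fin n) →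
              Dec (Classifies (_≢ zeroV) S kind)
classifies? S? kind = ∀-vec? λ x → nonzero? x →-dec
                        (S? (kind x) x ×-dec Fin.all? λ i → S? i x →-dec kind x Fin.≟ i)

surjective? : ∀ {n} (kind : V4 → Fin n) → Dec (SurjectiveOn (_≢ zeroV) kind)
surjective? kind = Fin.all? λ i → anySubset? λ x → nonzero? x ×-dec kind x Fin.≟ i

#C-ordering : ∀ {t} → t ∈ orderingsOfC → ∀ u → countTrue (List.map (inc? u) (toList t)) ≡ #C u
#C-ordering = ListAll.lookup (from-yes (ListAll.all? (λ t → ∀-vec? λ u →
                countTrue (List.map (inc? u) (toList t)) ℕ.≟ #C u) orderingsOfC))

#C-invariant : ∀ {M u u'} → InG₂ M → PlaneAct M u u' → #C u ≡ #C u'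
#C-invariant {M} {u} {u'} g act = begin
  countTrue (List.map (inc? u) cubicPts)                       ≡⟨ cong countTrue (List.map-cong inc-image cubicPts) ⟩
  countTrue (List.map (λ x → inc? u' (vecMat x M)) cubicPts)   ≡⟨ #C-ordering (G₂-permutes-C g) u' ⟩
  #C u'                                                        ∎
  where
  inc-image : ∀ x → inc? u x ≡ inc? u' (vecMat x M)
  inc-image x = cong not (Equivalence.to (PlaneAct⇔ M u u') act x)

-- The plane x₁ = x₂, in which P(0), P(1), P(∞) form a basis: x = α P(0) + β P(1) + γ P(∞)
-- for (α, β, γ) = coordinates x.
cPlane : V4
cPlane = false ∷ true ∷ true ∷ false ∷ []

coordinates : V4 → Vec F₂ 3
coordinates (x₀ ∷ x₁ ∷ _ ∷ x₃ ∷ []) = (x₃ xor x₁) ∷ x₁ ∷ (x₀ xor x₁) ∷ []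

OnC⇒Inc-cPlane : ∀ {x} → OnC x → Inc cPlane x
OnC⇒Inc-cPlane (here refl)                 = refl
OnC⇒Inc-cPlane (there (here refl))         = refl
OnC⇒Inc-cPlane (there (there (here refl))) = refl

Inc-cPlane⇒combination : ∀ x → Inc cPlane x → x ≡ combination (coordinates x) C⃗
Inc-cPlane⇒combination = from-yes (∀-vec? λ x → Inc? cPlane x →-dec x ≟V combination (coordinates x) C⃗)

pointKind-offCPlane : ∀ x → ¬ Inc cPlane x → pointKind x ≡ # 1
pointKind-offCPlane = from-yes (∀-vec? λ x → ¬? (Inc? cPlane x) →-dec pointKind x Fin.≟ # 1)

pointKind-ordering : ∀ {t} → t ∈ orderingsOfC → ∀ αs →
                     pointKind (combination αs t) ≡ pointKind (combination αs C⃗)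
pointKind-ordering = ListAll.lookup (from-yes (ListAll.all? (λ t → ∀-vec? λ αs →
                       pointKind (combination αs t) Fin.≟ pointKind (combination αs C⃗)) orderingsOfC))

G₂-reflects-cPlane : ∀ {M} → InG₂ M → ∀ x → Inc cPlane (vecMat x M) → Inc cPlane x
G₂-reflects-cPlane {M} g@((N , _ , MN≡I) , _) x xM∈π =
  subst (Inc cPlane) x≡combination (Inc-combination cPlane αs images∈π)
  where
  αs = coordinates (vecMat x M)
  x≡combination : combination αs (map (λ c → vecMat c N) C⃗) ≡ x
  x≡combination = begin
    combination αs (map (λ c → vecMat c N) C⃗)   ≡⟨ vecMat-combination αs C⃗ N ⟨
    vecMat (combination αs C⃗) N                 ≡⟨ cong (λ y → vecMat y N) (Inc-cPlane⇒combination _ xM∈π) ⟨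
    vecMat (vecMat x M) N                       ≡⟨ vecMat-cancel MN≡I x ⟩
    x                                           ∎
  image∈π : ∀ {c} → OnC c → Inc cPlane (vecMat c N)
  image∈π c∈C = OnC⇒Inc-cPlane (G₂-inverse-MapsC g _ c∈C)
  images∈π : All (Inc cPlane) (map (λ c → vecMat c N) C⃗)
  images∈π = image∈π (here refl) ∷ image∈π (there (here refl)) ∷ image∈π (there (there (here refl))) ∷ []

pointKind-G₂-invariant : ∀ {M} → InG₂ M → ∀ x → pointKind (vecMat x M) ≡ pointKind x
pointKind-G₂-invariant {M} g x with Inc? cPlane x
... | yes x∈π = begin
  pointKind (vecMat x M)                                   ≡⟨ cong (λ y → pointKind (vecMat y M)) x≡combination ⟩
  pointKind (vecMat (combination αs C⃗) M)                 ≡⟨ cong pointKind (vecMat-combination αs C⃗ M) ⟩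
  pointKind (combination αs (map (λ c → vecMat c M) C⃗))   ≡⟨ pointKind-ordering (G₂-permutes-C g) αs ⟩
  pointKind (combination αs C⃗)                            ≡⟨ cong pointKind x≡combination ⟨
  pointKind x                                              ∎
  where
  αs = coordinates x
  x≡combination = Inc-cPlane⇒combination x x∈π
... | no x∉π = trans (pointKind-offCPlane (vecMat x M) (x∉π ∘ G₂-reflects-cPlane g x))
                     (sym (pointKind-offCPlane x x∉π))

-- Transitivity and invariance by exhausting G₂*

module ActionChecks (Act : Mat → V4 → V4 → Set) (act? : ∀ M x y → Dec (Act M x y))
                    (act-matMul : ActionLaw Act) where

  LinkedByG₂* : ∀ {n} → (V4 → Fin n) → Set
  LinkedByG₂* kind = ∀ x y → x ≢ zeroV → y ≢ zeroV → kind x ≡ kind y → ∃ λ v → det v ≡ true × Act (Mv v) x y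

  PreservedByG₂* : ∀ {n} → (V4 → Fin n) → Set
  PreservedByG₂* kind = ∀ v → det v ≡ true → ∀ x y → Act (Mv v) x y → kind x ≡ kind y

  BridgedByK : ∀ {m n} → (V4 → Fin m) → (V4 → Fin n) → Set
  BridgedByK kind kind* = ∀ x y → x ≢ zeroV → y ≢ zeroV → kind x ≡ kind y → kind* x ≢ kind* y →
                          ∃ λ x₀ → (x₀ ≢ zeroV × kind* x₀ ≡ kind* x) ×
                          ∃ λ x₁ → (x₁ ≢ zeroV × kind* x₁ ≡ kind* y) × Act K x₀ x₁

  linkedByG₂*? : ∀ {n} (kind : V4 → Fin n) → Dec (LinkedByG₂* kind)
  linkedByG₂*? kind = ∀-vec? λ x → ∀-vec? λ y → nonzero? x →-dec (nonzero? y →-dec (kind x Fin.≟ kind y →-dec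
                        anySubset? λ v → det v Bool.≟ true ×-dec act? (Mv v) x y))

  preservedByG₂*? : ∀ {n} (kind : V4 → Fin n) → Dec (PreservedByG₂* kind)
  preservedByG₂*? kind = ∀-vec? λ v → det v Bool.≟ true →-dec ∀-vec? λ x → ∀-vec? λ y →
                           act? (Mv v) x y →-dec kind x Fin.≟ kind y

  bridgedByK? : ∀ {m n} (kind : V4 → Fin m) (kind* : V4 → Fin n) → Dec (BridgedByK kind kind*)
  bridgedByK? kind kind* = ∀-vec? λ x → ∀-vec? λ y → nonzero? x →-dec (nonzero? y →-dec (kind x Fin.≟ kind y →-dec
                             (¬? (kind* x Fin.≟ kind* y) →-dec
                              anySubset? λ x₀ → (nonzero? x₀ ×-dec kind* x₀ Fin.≟ kind* x) ×-dec
                              anySubset? λ x₁ → (nonzero? x₁ ×-dec kind* x₁ Fin.≟ kind* y) ×-dec act? K x₀ x₁)))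

  G₂*-transitive : ∀ {n} (kind : V4 → Fin n) → LinkedByG₂* kind → TransitiveOnFibres InG₂* Act (_≢ zeroV) kind
  G₂*-transitive kind linked x y x≢0 y≢0 eq with linked x y x≢0 y≢0 eq
  ... | v , det≡1 , act = Mv v , InG₂*-Mv v det≡1 , act

  G₂*-invariant : ∀ {n} (kind : V4 → Fin n) → PreservedByG₂* kind → Invariant InG₂* Act kind
  G₂*-invariant kind preserved _ x y (a , b , c , d , det≡1 , refl) act =
    preserved (a ∷ b ∷ c ∷ d ∷ []) det≡1 x y act

  Reach*⇒Reach : ∀ {x y} → Reach InG₂* Act x y → Reach InG₂ Act x y
  Reach*⇒Reach (M , g , act) = M , InG₂*⇒InG₂ g , act

  Reach-trans : ∀ {x y z} → Reach InG₂ Act x y → Reach InG₂ Act y z → Reach InG₂ Act x z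
  Reach-trans {x} {y} {z} (M , g , act) (M' , g' , act') =
    matMul M M' , InG₂-matMul g g' , act-matMul M M' x y z act act'

  G₂-transitive : ∀ {m n} (kind : V4 → Fin m) (kind* : V4 → Fin n) →
                  LinkedByG₂* kind* → BridgedByK kind kind* → TransitiveOnFibres InG₂ Act (_≢ zeroV) kind
  G₂-transitive kind kind* linked bridged x y x≢0 y≢0 eq with kind* x Fin.≟ kind* y
  ... | yes eq* = Reach*⇒Reach (G₂*-transitive kind* linked x y x≢0 y≢0 eq*)
  ... | no  neq* with bridged x y x≢0 y≢0 eq neq*
  ...   | x₀ , (x₀≢0 , eq₀) , x₁ , (x₁≢0 , eq₁) , actK =
    Reach-trans (Reach*⇒Reach (G₂*-transitive kind* linked x x₀ x≢0 x₀≢0 (sym eq₀)))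
      (Reach-trans (K , InG₂-K , actK) (Reach*⇒Reach (G₂*-transitive kind* linked x₁ y x₁≢0 y≢0 eq₁)))

module PointChecks = ActionChecks PointAct pointAct? PointAct-matMul
module PlaneChecks = ActionChecks PlaneAct planeAct? PlaneAct-matMul

planeKind*-linked : PlaneChecks.LinkedByG₂* planeKind*
planeKind*-linked = from-yes (PlaneChecks.linkedByG₂*? planeKind*)

pointKind*-linked : PointChecks.LinkedByG₂* pointKind*
pointKind*-linked = from-yes (PointChecks.linkedByG₂*? pointKind*)

planeKind-classifies : Classifies IsPlane G₂PlaneOrbits planeKind
planeKind-classifies = from-yes (classifies? G₂PlaneOrbits? planeKind)

planeKind-surjective : SurjectiveOn IsPlane planeKind
planeKind-surjective = from-yes (surjective? planeKind)

planeKind-transitive : TransitiveOnFibres InG₂ PlaneAct IsPlane planeKind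
planeKind-transitive = PlaneChecks.G₂-transitive planeKind planeKind* planeKind*-linked
                         (from-yes (PlaneChecks.bridgedByK? planeKind planeKind*))

planeKind-invariant : Invariant InG₂ PlaneAct planeKind
planeKind-invariant M u u' g act = cong byCount (#C-invariant {M} {u} {u'} g act)

pointKind-classifies : Classifies IsPoint G₂PointOrbits pointKind
pointKind-classifies = from-yes (classifies? G₂PointOrbits? pointKind)

pointKind-surjective : SurjectiveOn IsPoint pointKind
pointKind-surjective = from-yes (surjective? pointKind)

pointKind-transitive : TransitiveOnFibres InG₂ PointAct IsPoint pointKind
pointKind-transitive = PointChecks.G₂-transitive pointKind pointKind* pointKind*-linked
                         (from-yes (PointChecks.bridgedByK? pointKind pointKind*))

pointKind-invariant : Invariant InG₂ PointAct pointKind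
pointKind-invariant M x _ g refl = sym (pointKind-G₂-invariant g x)

planeKind*-classifies : Classifies IsPlane G₂*PlaneOrbits planeKind*
planeKind*-classifies = from-yes (classifies? G₂*PlaneOrbits? planeKind*)

planeKind*-surjective : SurjectiveOn IsPlane planeKind*
planeKind*-surjective = from-yes (surjective? planeKind*)

planeKind*-transitive : TransitiveOnFibres InG₂* PlaneAct IsPlane planeKind*
planeKind*-transitive = PlaneChecks.G₂*-transitive planeKind* planeKind*-linked

planeKind*-invariant : Invariant InG₂* PlaneAct planeKind*
planeKind*-invariant = PlaneChecks.G₂*-invariant planeKind* (from-yes (PlaneChecks.preservedByG₂*? planeKind*))

pointKind*-classifies : Classifies IsPoint G₂*PointOrbits pointKind*
pointKind*-classifies = from-yes (classifies? G₂*PointOrbits? pointKind*)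

pointKind*-surjective : SurjectiveOn IsPoint pointKind*
pointKind*-surjective = from-yes (surjective? pointKind*)

pointKind*-transitive : TransitiveOnFibres InG₂* PointAct IsPoint pointKind*
pointKind*-transitive = PointChecks.G₂*-transitive pointKind* pointKind*-linked

pointKind*-invariant : Invariant InG₂* PointAct pointKind*
pointKind*-invariant = PointChecks.G₂*-invariant pointKind* (from-yes (PointChecks.preservedByG₂*? pointKind*))

theorem4p2 : IsOrbitPartition InG₂ PlaneAct IsPlane 4 G₂PlaneOrbits
             × IsOrbitPartition InG₂ PointAct IsPoint 4 G₂PointOrbits
             × IsOrbitPartition InG₂* PlaneAct IsPlane 5 G₂*PlaneOrbits
             × IsOrbitPartition InG₂* PointAct IsPoint 5 G₂*PointOrbits
theorem4p2 =
    isOrbitPartition-byCompleteInvariant planeKind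
      planeKind-classifies planeKind-surjective planeKind-transitive planeKind-invariant
  , isOrbitPartition-byCompleteInvariant pointKind
      pointKind-classifies pointKind-surjective pointKind-transitive pointKind-invariant
  , isOrbitPartition-byCompleteInvariant planeKind*
      planeKind*-classifies planeKind*-surjective planeKind*-transitive planeKind*-invariant
  , isOrbitPartition-byCompleteInvariant pointKind*
      pointKind*-classifies pointKind*-surjective pointKind*-transitive pointKind*-invariant
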